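{- Let $(N_1,m_1)\vartriangleright_E(N_2,m_2)$ with both marked nets safe, let $G$ be a well-formed TFG for this equivalence, and let $\mathcal{C}$ be the concurrency relation of $G$; write $v\,\bar{\mathcal{C}}\,w$ for $\neg(v\,\mathcal{C}\,w)$. Let $v$ be a node of $G$ such that $v\mathbin{\circ\!\to} X$ or $X\mathbin{\to\!\bullet} v$. Then for every node $v'$ with $v\,\bar{\mathcal{C}}\,v'$ we have $w\,\bar{\mathcal{C}}\,v'$ for every $w\in X$. Conversely, for every node $v'$, if $w\,\bar{\mathcal{C}}\,v'$ for every $w\in X$, then $v\,\bar{\mathcal{C}}\,v'$.
   Context: A Petri net $N=(P,T,\mathrm{Pre},\mathrm{Post})$ has a finite set of places $P$, a finite set of transitions $T$, and flow functions $\mathrm{Pre},\mathrm{Post}:T\to(P\to\mathbb{N})$. A marking is $m:P\to\mathbb{N}$; $t$ is enabled at $m$ if $m\ge\mathrm{Pre}(t)$, and firing gives $m-\mathrm{Pre}(t)+\mathrm{Post}(t)$. $R(N,m_0)$ is the set of markings reachable from $m_0$ by finite (possibly empty) firing sequences. $(N,m_0)$ is safe if every reachable marking has at most one token in each place. Linear systems: $E$ is a finite collection of equations $x=y_1+\dots+y_l$, with variable set $\mathrm{fv}(E)$; solutions are non-negative integer; consistent means having a solution. For a partial map $c$ defined exactly on $v_1,\dots,v_k$, $[c]$ is the system $v_1=c(v_1),\dots,v_k=c(v_k)$; commas denote union. $E$-equivalence: $(N_1,m_1)\vartriangleright_E(N_2,m_2)$ (place sets $P_1,P_2$) iff (A1)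 $E,[m]$ consistent for every $m\in R(N_1,m_1)\cup R(N_2,m_2)$; (A2) $E,[m_1],[m_2]$ consistent; (A3) for all markings $m_1'$ of $N_1$, $m_2'$ of $N_2$ with $E,[m_1'],[m_2']$ consistent, $m_1'\in R(N_1,m_1)\iff m_2'\in R(N_2,m_2)$. TFGs: fix pairwise disjoint sets $K(n)$, $n\in\mathbb{N}$, of constant nodes of value $n$, disjoint from place/variable names; $K=\bigcup_nK(n)$. A TFG with places $P$ is $(V,R,A)$, $V=P\cup S$ with $S\subset K$ finite, $R,A\subseteq V\times V$ disjoint; $v\mathbin{\to\!\bullet} w$ iff $(v,w)\in R$, $v\mathbin{\circ\!\to} w$ iff $(v,w)\in A$, $v\to w$ for either. Roots have no incoming arc; $\circ$-leaves have no outgoing $A$-arc. $v\mathbin{\circ\!\to} X$: $X$ is the nonempty set of all $A$-successors of $v$; $X\mathbin{\to\!\bullet} v$: $X$ is the nonempty set of all $R$-predecessors of $v$. Well-formed TFG for $(N_1,m_1)\vartriangleright_E(N_2,m_2)$: (T1) $V\setminus K=P_1\cup P_2\cup\mathrm{fv}(E)$; (T2) nodes in $V\cap K$ are roots; (T3) not both $p\mathbin{\circ\!\to} q$ and $p'\to q$ with $p\ne p'$, and not both $p\mathbin{\to\!\bullet} q$ and $p\mathbin{\circ\!\to} q$; (T4) $v\mathbin{\circ\!\to} X$ or $X\mathbin{\to\!\bullet} v$ iff the equation $v=\sum_{x\in X}x$ is in $E$; (T5) acyclic; (T6) roots not in $K$ are exactly $P_2$, $\circ$-leaves not in $K$ exactly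 $P_1$. A configuration is a partial $c:V\to\mathbb{N}$ ($\bot$ where undefined) with $c(v)=n$ for $v\in V\cap K(n)$; total if defined everywhere; $c_{|N}$ is its restriction to the places of $N$. $c$ is well-defined if (CBot) whenever $v\to w$, $c(v)=\bot\iff c(w)=\bot$; (CEq) whenever $c(v)\ne\bot$ and ($v\mathbin{\circ\!\to} X$ or $X\mathbin{\to\!\bullet} v$), $c(v)=\sum_{x\in X}c(x)$. The concurrency relation $\mathcal{C}$ of $G$: $v\,\mathcal{C}\,w$ iff there is a total, well-defined configuration $c$ with $c_{|N_2}\in R(N_2,m_2)$, $c(v)>0$ and $c(w)>0$. -}

module Defs where

open import Data.Nat using (ℕ; _≤_; _<_)
open import Data.Fin using (Fin)
open import Data.Product using (Σ; ∃; _×_; _,_)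
open import Data.Sum using (_⊎_)
open import Data.List using (List; []; map; filter)
open import Data.Nat.ListAction using (sum)
open import Data.List.Membership.Propositional using (_∈_)
open import Data.List.Relation.Unary.All using (All)
open import Data.List.Relation.Unary.Any using (Any)
open import Data.List.Relation.Unary.Unique.Propositional using (Unique)
open import Data.List.Relation.Binary.Permutation.Propositional using (_↭_)
open import Relation.Binary.Construct.Closure.Transitive using (TransClosure)
open import Relation.Binary.PropositionalEquality using (_≡_; _≢_)
open import Relation.Nullary using (¬_)
open import Relation.Unary using (Decidable)
open import Function.Definitions using (Injective)
open import Function.Bundles using (_⇔_)

Name : Set
Name = ℕ

-- The constant node  inj₂ (n , i)  is the i-th element of K(n), i.e. it
-- has value n.  The sets K(n) are thus pairwise disjoint and disjoint
-- from the names.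
Node : Set
Node = Name ⊎ (ℕ × ℕ)

pattern var x      = Data.Sum.inj₁ x
pattern cst n i    = Data.Sum.inj₂ (n , i)

record Net : Set where
  field
    np     : ℕ
    pl     : Fin np → Name
    pl-inj : Injective _≡_ _≡_ pl
    nt     : ℕ
    Pre    : Fin nt → Fin np → ℕ
    Post   : Fin nt → Fin np → ℕ

open Net public

Marking : Net → Set
Marking N = Fin (np N) → ℕ

Enabled : (N : Net) → Fin (nt N) → Marking N → Set
Enabled N t m = ∀ p → Pre N t p ≤ m p

Fires : (N : Net) → Marking N → Fin (nt N) → Marking N → Set
Fires N m t m' = Enabled N t m × (∀ p → m' p ≡ (m p Data.Nat.∸ Pre N t p) Data.Nat.+ Post N t p)

-- Reach N m0 m :  m ∈ R(N, m0)  (markings compared pointwise)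
data Reach (N : Net) (m0 : Marking N) : Marking N → Set where
  here : ∀ {m} → (∀ p → m p ≡ m0 p) → Reach N m0 m
  step : ∀ {m m'} (t : Fin (nt N)) → Reach N m0 m → Fires N m t m' → Reach N m0 m'

Safe : (N : Net) → Marking N → Set
Safe N m0 = ∀ m → Reach N m0 m → ∀ p → m p ≤ 1

IsPlace : Net → Name → Set
IsPlace N x = ∃ λ p → pl N p ≡ x

-- An equation  x = y₁ + … + yₗ  (terms are variables or constants).
Equation : Set
Equation = Node × List Node

System : Set
System = List Equation

Occurs : Name → Equation → Set
Occurs x (y , ys) = var x ≡ y ⊎ var x ∈ ys

fv : System → Name → Set
fv E x = Any (Occurs x) E

val : (Name → ℕ) → Node → ℕ
val a (var x)   = a x
val a (cst n i) = n

Solves : (Name → ℕ) → System → Set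
Solves a E = All (λ { (x , ys) → val a x ≡ sum (map (val a) ys) }) E

-- a satisfies the system [m] for a marking m of N
Agrees : (N : Net) → Marking N → (Name → ℕ) → Set
Agrees N m a = ∀ p → a (pl N p) ≡ m p

Consistent₁ : System → (N : Net) → Marking N → Set
Consistent₁ E N m = ∃ λ a → Solves a E × Agrees N m a

Consistent₂ : System → (N₁ : Net) → Marking N₁ → (N₂ : Net) → Marking N₂ → Set
Consistent₂ E N₁ m₁ N₂ m₂ = ∃ λ a → Solves a E × Agrees N₁ m₁ a × Agrees N₂ m₂ a

record EEquiv (N₁ : Net) (m₁ : Marking N₁) (E : System) (N₂ : Net) (m₂ : Marking N₂) : Set where
  field
    A1₁ : ∀ m → Reach N₁ m₁ m → Consistent₁ E N₁ m
    A1₂ : ∀ m → Reach N₂ m₂ m → Consistent₁ E N₂ m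
    A2  : Consistent₂ E N₁ m₁ N₂ m₂
    A3  : ∀ m₁' m₂' → Consistent₂ E N₁ m₁' N₂ m₂' → (Reach N₁ m₁ m₁' ⇔ Reach N₂ m₂ m₂')

record TFG : Set₁ where
  field
    V      : List Node
    V-uniq : Unique V
    R      : Node → Node → Set      -- v →• w
    A      : Node → Node → Set      -- v ∘→ w
    R?     : ∀ v → Decidable (R v)
    A?     : ∀ v → Decidable (A v)
    R-in   : ∀ {v w} → R v w → v ∈ V × w ∈ V
    A-in   : ∀ {v w} → A v w → v ∈ V × w ∈ V
    RA-disj : ∀ {v w} → R v w → ¬ A v w

open TFG public

module _ (G : TFG) where

  Arc : Node → Node → Set
  Arc v w = R G v w ⊎ A G v w

  Root : Node → Set
  Root v = ∀ u → ¬ Arc u v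

  OLeaf : Node → Set
  OLeaf v = ∀ u → ¬ A G v u

  succA : Node → List Node
  succA v = filter (A? G v) (V G)

  predR : Node → List Node
  predR v = filter (λ u → R? G u v) (V G)

  -- v ∘→ X  (X a listing of the set of all A-successors, nonempty)
  OArrTo : Node → List Node → Set
  OArrTo v X = X ↭ succA v × X ≢ []

  RArrFrom : List Node → Node → Set
  RArrFrom X v = X ↭ predR v × X ≢ []

record WellFormed (G : TFG) (N₁ : Net) (E : System) (N₂ : Net) : Set where
  field
    T1 : ∀ x → (var x ∈ V G ⇔ (IsPlace N₁ x ⊎ IsPlace N₂ x ⊎ fv E x))
    T2 : ∀ n i → cst n i ∈ V G → Root G (cst n i)
    T3a : ∀ p p' q → A G p q → Arc G p' q → p ≡ p'
    T3b : ∀ p q → R G p q → ¬ A G p q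
    -- the equation v = Σ_{x∈X} x (summands listed in any order)
    T4 : ∀ v X → ((OArrTo G v X ⊎ RArrFrom G X v) ⇔ (∃ λ ys → (v , ys) ∈ E × ys ↭ X))
    T5 : ∀ v → ¬ TransClosure (Arc G) v v
    T6a : ∀ x → var x ∈ V G → (Root G (var x) ⇔ IsPlace N₂ x)
    T6b : ∀ x → var x ∈ V G → (OLeaf G (var x) ⇔ IsPlace N₁ x)

-- A total configuration: a value for every node of V (values outside V
-- are irrelevant).  Constants carry their value.
TotalWellDefined : TFG → (Node → ℕ) → Set
TotalWellDefined G c =
    (∀ n i → cst n i ∈ V G → c (cst n i) ≡ n)
  × (∀ v X → (OArrTo G v X ⊎ RArrFrom G X v) → c v ≡ sum (map c X))
  -- (CBot holds trivially for total configurations)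

restrict : (N : Net) → (Node → ℕ) → Marking N
restrict N c p = c (var (pl N p))

Conc : TFG → (N₂ : Net) → Marking N₂ → Node → Node → Set
Conc G N₂ m₂ v w =
  ∃ λ (c : Node → ℕ) → TotalWellDefined G c × Reach N₂ m₂ (restrict N₂ c)
                      × 0 < c v × 0 < c w

{-# OPTIONS --safe #-}
module Submission where

-- The node v carries the equation v = Σ_{w ∈ X} w in every total well-defined
-- configuration, so in each such configuration c we have c v > 0 exactly when
-- c w > 0 for some w ∈ X. Non-concurrency is the absence of a configuration
-- with two positive values, and both directions follow at once.

open import Defs
open import Data.Product using (_×_; _,_; ∃; proj₂)
open import Data.Sum using (_⊎_)
open import Data.List using (List; []; _∷_; map)
open import Data.Nat using (ℕ; zero; suc; _≤_; _<_; z≤n; s≤s)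
open import Data.Nat.Properties using (≤-trans; m≤m+n; m≤n+m; <-≤-trans)
open import Data.Nat.ListAction using (sum)
open import Data.List.Membership.Propositional using (_∈_)
open import Data.List.Relation.Unary.Any using (here; there)
open import Relation.Binary.PropositionalEquality using (_≡_; refl; sym; subst)
open import Relation.Nullary using (¬_)

module _ {A : Set} (f : A → ℕ) where

  ∈⇒≤sum-map : ∀ {x xs} → x ∈ xs → f x ≤ sum (map f xs)
  ∈⇒≤sum-map {xs = x ∷ _}  (here refl) = m≤m+n (f x) _
  ∈⇒≤sum-map {xs = y ∷ _}  (there x∈xs) = ≤-trans (∈⇒≤sum-map x∈xs) (m≤n+m _ (f y))

  sum-map-pos⇒∃-pos : ∀ xs → 0 < sum (map f xs) → ∃ λ x → x ∈ xs × 0 < f x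
  sum-map-pos⇒∃-pos (x ∷ xs) pos with f x in fx≡
  ... | suc _ = x , here refl , subst (0 <_) (sym fx≡) (s≤s z≤n)
  ... | zero with sum-map-pos⇒∃-pos xs pos
  ...   | y , y∈xs , fy>0 = y , there y∈xs , fy>0

module _ (G : TFG) {v : Node} {X : List Node} (v≐X : OArrTo G v X ⊎ RArrFrom G X v)
         {c : Node → ℕ} (wd : TotalWellDefined G c) where

  c-sum : c v ≡ sum (map c X)
  c-sum = proj₂ wd v X v≐X

  member-pos⇒pos : ∀ {w} → w ∈ X → 0 < c w → 0 < c v
  member-pos⇒pos w∈X cw>0 =
    subst (0 <_) (sym c-sum) (<-≤-trans cw>0 (∈⇒≤sum-map c w∈X))

  pos⇒member-pos : 0 < c v → ∃ λ w → w ∈ X × 0 < c w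
  pos⇒member-pos cv>0 = sum-map-pos⇒∃-pos c X (subst (0 <_) c-sum cv>0)

lemma13 : (N₁ N₂ : Net) (m₁ : Marking N₁) (m₂ : Marking N₂) (E : System)
          → Safe N₁ m₁ → Safe N₂ m₂ → EEquiv N₁ m₁ E N₂ m₂
          → (G : TFG) → WellFormed G N₁ E N₂
          → (v : Node) → v ∈ V G → (X : List Node)
          → (OArrTo G v X ⊎ RArrFrom G X v)
          → (∀ v' → v' ∈ V G → ¬ Conc G N₂ m₂ v v'
               → ∀ w → w ∈ X → ¬ Conc G N₂ m₂ w v')
            × (∀ v' → v' ∈ V G → (∀ w → w ∈ X → ¬ Conc G N₂ m₂ w v')
               → ¬ Conc G N₂ m₂ v v')
lemma13 N₁ N₂ m₁ m₂ E _ _ _ G _ v _ X v≐X = split , join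
  where
  split : ∀ v' → v' ∈ V G → ¬ Conc G N₂ m₂ v v' → ∀ w → w ∈ X → ¬ Conc G N₂ m₂ w v'
  split v' _ v∦v' w w∈X (c , wd , reach , cw>0 , cv'>0) =
    v∦v' (c , wd , reach , member-pos⇒pos G v≐X wd w∈X cw>0 , cv'>0)

  join : ∀ v' → v' ∈ V G → (∀ w → w ∈ X → ¬ Conc G N₂ m₂ w v') → ¬ Conc G N₂ m₂ v v'
  join v' _ X∦v' (c , wd , reach , cv>0 , cv'>0) with pos⇒member-pos G v≐X wd cv>0
  ... | w , w∈X , cw>0 = X∦v' w w∈X (c , wd , reach , cw>0 , cv'>0)
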